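{- Let $q\ge5$, and assume that $q$ is even or that $-1/2$ is not a cube in $\mathbb{F}_q$. Let $L$ be the line through $\mathrm{P}(1,0,0,1)$ and $\mathrm{P}(0,0,1,0)$ and $G_q^{L}$ the subgroup of $G_q$ fixing $L$. Then every element of $G_q^{L}$ is induced by a matrix $\mathrm{diag}(1,d,d^2,d^3)$ with $d\in\mathbb{F}_q^*$ a cube root of unity.
   Context: $\mathrm{P}(x_0,x_1,x_2,x_3)$ denotes a point of $\mathrm{PG}(3,q)$ in homogeneous coordinates; a matrix $M$ induces the projectivity $\mathrm{P}(x)\mapsto\mathrm{P}(xM)$ ($x$ a row vector). The twisted cubic is $\mathcal{C}=\{P(t): t\in\mathbb{F}_q\cup\{\infty\}\}$, $P(t)=\mathrm{P}(t^3,t^2,t,1)$ for $t\in\mathbb{F}_q$, $P(\infty)=\mathrm{P}(1,0,0,0)$. $G_q$ is the group of projectivities mapping $\mathcal{C}$ onto itself; for $q\ge 5$ its elements are exactly those induced by $M=\begin{pmatrix} a^3&a^2c&ac^2&c^3\\ 3a^2b&a^2d+2abc&bc^2+2acd&3c^2d\\ 3ab^2&b^2c+2abd&ad^2+2bcd&3cd^2\\ b^3&b^2d&bd^2&d^3\end{pmatrix}$, $a,b,c,d\in\mathbb{F}_q$, $ad-bc\ne0$ (up to nonzero scalar). -}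

module Defs where

open import Level using (Level; _⊔_)
open import Algebra.Bundles using (CommutativeRing)
open import Data.Fin using (Fin; zero; suc)
open import Data.Nat using (ℕ)
open import Data.Product using (Σ; ∃; _×_)
open import Relation.Nullary using (¬_)
open import Function.Bundles using (Inverse)
import Relation.Binary.PropositionalEquality as ≡

-- A field, presented as a commutative ring with 1 ≠ 0 in which every
-- nonzero element has a multiplicative inverse (agda-stdlib has no Field bundle).
record IsField {c ℓ : Level} (R : CommutativeRing c ℓ) : Set (c ⊔ ℓ) where
  open CommutativeRing R hiding (zero)
  field
    1≉0     : ¬ (1# ≈ 0#)
    inverse : ∀ x → ¬ (x ≈ 0#) → ∃ λ y → (x * y) ≈ 1#

HasOrder : {c ℓ : Level} → CommutativeRing c ℓ → ℕ → Set (c ⊔ ℓ)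
HasOrder R q = Inverse (≡.setoid (Fin q)) (CommutativeRing.setoid R)

module Geometry {c ℓ : Level} (R : CommutativeRing c ℓ) where
  open CommutativeRing R hiding (zero)

  two three : Carrier
  two = 1# + 1#
  three = two + 1#

  _³ : Carrier → Carrier
  x ³ = x * x * x

  -- vectors of F_q^4 (homogeneous coordinates) and 4×4 matrices
  Vec4 : Set c
  Vec4 = Fin 4 → Carrier

  Mat4 : Set c
  Mat4 = Fin 4 → Fin 4 → Carrier

  _·ᴹ_ : Vec4 → Mat4 → Vec4
  (x ·ᴹ M) j = x zero * M zero j + x (suc zero) * M (suc zero) j
             + x (suc (suc zero)) * M (suc (suc zero)) j
             + x (suc (suc (suc zero))) * M (suc (suc (suc zero))) j

  NonZeroVec : Vec4 → Set ℓ
  NonZeroVec x = ¬ (∀ i → x i ≈ 0#)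

  SamePoint : Vec4 → Vec4 → Set (c ⊔ ℓ)
  SamePoint x y = ∃ λ k → ¬ (k ≈ 0#) × (∀ i → y i ≈ k * x i)

  -- the matrix M(a,b,c,d) of the context, rows indexed first
  Mabcd : Carrier → Carrier → Carrier → Carrier → Mat4
  Mabcd a b c' d zero zero = a ³
  Mabcd a b c' d zero (suc zero) = a * a * c'
  Mabcd a b c' d zero (suc (suc zero)) = a * c' * c'
  Mabcd a b c' d zero (suc (suc (suc zero))) = c' ³
  Mabcd a b c' d (suc zero) zero = three * a * a * b
  Mabcd a b c' d (suc zero) (suc zero) = a * a * d + two * a * b * c'
  Mabcd a b c' d (suc zero) (suc (suc zero)) = b * c' * c' + two * a * c' * d
  Mabcd a b c' d (suc zero) (suc (suc (suc zero))) = three * c' * c' * d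
  Mabcd a b c' d (suc (suc zero)) zero = three * a * b * b
  Mabcd a b c' d (suc (suc zero)) (suc zero) = b * b * c' + two * a * b * d
  Mabcd a b c' d (suc (suc zero)) (suc (suc zero)) = a * d * d + two * b * c' * d
  Mabcd a b c' d (suc (suc zero)) (suc (suc (suc zero))) = three * c' * d * d
  Mabcd a b c' d (suc (suc (suc zero))) zero = b ³
  Mabcd a b c' d (suc (suc (suc zero))) (suc zero) = b * b * d
  Mabcd a b c' d (suc (suc (suc zero))) (suc (suc zero)) = b * d * d
  Mabcd a b c' d (suc (suc (suc zero))) (suc (suc (suc zero))) = d ³

  diagCube : Carrier → Mat4
  diagCube d zero zero = 1#
  diagCube d (suc zero) (suc zero) = d
  diagCube d (suc (suc zero)) (suc (suc zero)) = d * d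
  diagCube d (suc (suc (suc zero))) (suc (suc (suc zero))) = d ³
  diagCube d _ _ = 0#

  -- L = line through P(1,0,0,1) and P(0,0,1,0):
  -- its points are the P(x) with x = λ(1,0,0,1) + μ(0,0,1,0), i.e. x₁ = 0 and x₀ = x₃
  OnL : Vec4 → Set ℓ
  OnL x = (x (suc zero) ≈ 0#) × (x zero ≈ x (suc (suc (suc zero))))

  -- the projectivity P(x) ↦ P(xM) maps L onto L
  FixesL : Mat4 → Set (c ⊔ ℓ)
  FixesL M = (∀ x → NonZeroVec x → OnL x → OnL (x ·ᴹ M))
           × (∀ y → NonZeroVec y → OnL y →
                ∃ λ x → NonZeroVec x × OnL x × SamePoint (x ·ᴹ M) y)

  SameProjectivity : Mat4 → Mat4 → Set (c ⊔ ℓ)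
  SameProjectivity M N = ∃ λ k → ¬ (k ≈ 0#) × (∀ i j → N i j ≈ k * M i j)

-- The points P(1,0,0,1) and P(0,0,1,0) of L must be mapped into L, i.e. their images
-- satisfy x₁ = 0 and x₀ = x₃. This gives a²c + b²d = 0, a³ + b³ = c³ + d³,
-- b²c + 2abd = 0 and 3ab² = 3cd². If b = 0, then c = 0 and a³ = d³, so M(a,b,c,d) is
-- a³·diag(1,e,e²,e³) with e = d/a and e³ = 1. If b ≠ 0, then bc = −2ad, so ad − bc = 3ad ≠ 0,
-- 2 ≠ 0 (else c = 0 and b²d = 0), and a(b³ + 2d³) = 0, so x = d/b satisfies 2x³ = −1. This
-- contradicts the hypothesis: when 2 ≠ 0, negation is an involution of F_q fixing only 0,
-- so q is odd.

module Submission where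

open import Defs
open import Level using (Level)
open import Algebra.Bundles using (CommutativeRing)
open import Data.Nat using (ℕ; _≥_)
open import Data.Nat.Divisibility using (_∣_)
open import Data.Product using (∃; _×_)
open import Data.Sum using (_⊎_)
open import Relation.Nullary using (¬_)

open import Data.Empty using (⊥-elim)
open import Data.Fin as Fin using (Fin)
open import Data.Fin.Patterns using (0F; 1F; 2F; 3F)
open import Data.Product using (_,_; proj₁; proj₂)
open import Data.Sum using ([_,_])
open import Function.Bundles using (Inverse)
open import Relation.Binary.Definitions using (Decidable)
open import Relation.Nullary using (Dec; yes; no)
import Relation.Binary.PropositionalEquality as ≡

module InvolutionParity where
  open import Data.Nat using (zero; suc; _+_; _*_)
  open import Data.Nat.Divisibility using (divides)
  open import Data.Nat.Properties using (+-0-commutativeMonoid; +-comm; +-identityʳ; *-comm; even≢odd)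
  open import Data.Fin using (_<?_; _≟_; punchIn)
  open import Data.Fin.Properties using (<-cmp; <-asym; <-irrefl; punchInᵢ≢i)
  open import Data.Fin.Permutation using (permutation)
  open import Algebra.Properties.CommutativeMonoid.Sum +-0-commutativeMonoid
    using (sum; sum-syntax; sum-cong-≗; ∑-distrib-+; ∑-permute; sum-remove; sum-replicate-zero)
  open import Relation.Binary.Definitions using (tri<; tri≈; tri>)
  open import Relation.Nullary using (contradiction)
  open import Relation.Binary.PropositionalEquality
    using (_≡_; refl; sym; trans; cong; cong₂; module ≡-Reasoning)

  [_] : ∀ {p} {P : Set p} → Dec P → ℕ
  [ yes _ ] = 1
  [ no _ ] = 0

  trichotomy-count : ∀ {n} (i j : Fin n) → [ i <? j ] + [ j <? i ] + [ i ≟ j ] ≡ 1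
  trichotomy-count i j with i <? j | j <? i | i ≟ j
  ... | yes i<j | yes j<i | _      = contradiction j<i (<-asym i<j)
  ... | yes i<i | no _    | yes refl = contradiction i<i (<-irrefl refl)
  ... | yes _   | no _    | no _   = refl
  ... | no _    | yes i<i | yes refl = contradiction i<i (<-irrefl refl)
  ... | no _    | yes _   | no _   = refl
  ... | no _    | no _    | yes _  = refl
  ... | no i≮j  | no j≮i  | no i≢j with <-cmp i j
  ...   | tri< i<j _ _ = contradiction i<j i≮j
  ...   | tri≈ _ i≡j _ = contradiction i≡j i≢j
  ...   | tri> _ _ j<i = contradiction j<i j≮i

  ∑-const-1 : ∀ n → ∑[ i < n ] 1 ≡ n
  ∑-const-1 zero = refl
  ∑-const-1 (suc n) = cong suc (∑-const-1 n)

  module _ {n : ℕ} (σ : Fin n → Fin n) (σ-involutive : ∀ i → σ (σ i) ≡ i) where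

    ∑[σi<i]≡∑[i<σi] : ∑[ i < n ] [ σ i <? i ] ≡ ∑[ i < n ] [ i <? σ i ]
    ∑[σi<i]≡∑[i<σi] = begin
      ∑[ i < n ] [ σ i <? i ]
        ≡⟨ sum-cong-≗ (λ i → cong (λ j → [ σ i <? j ]) (σ-involutive i)) ⟨
      ∑[ i < n ] [ σ i <? σ (σ i) ]
        ≡⟨ ∑-permute (λ i → [ i <? σ i ]) (permutation σ σ σ-involutive σ-involutive) ⟨
      ∑[ i < n ] [ i <? σ i ]
        ∎
      where open ≡-Reasoning

    involution-count : n ≡ 2 * ∑[ i < n ] [ i <? σ i ] + ∑[ i < n ] [ i ≟ σ i ]
    involution-count = begin
      n
        ≡⟨ ∑-const-1 n ⟨
      ∑[ i < n ] 1
        ≡⟨ sum-cong-≗ (λ i → trichotomy-count i (σ i)) ⟨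
      ∑[ i < n ] ([ i <? σ i ] + [ σ i <? i ] + [ i ≟ σ i ])
        ≡⟨ ∑-distrib-+ (λ i → [ i <? σ i ] + [ σ i <? i ]) _ ⟩
      ∑[ i < n ] ([ i <? σ i ] + [ σ i <? i ]) + F
        ≡⟨ cong (_+ F) (∑-distrib-+ (λ i → [ i <? σ i ]) (λ i → [ σ i <? i ])) ⟩
      S + ∑[ i < n ] [ σ i <? i ] + F
        ≡⟨ cong (λ x → S + x + F) (trans ∑[σi<i]≡∑[i<σi] (sym (+-identityʳ S))) ⟩
      2 * S + F
        ∎
      where
      open ≡-Reasoning
      S = ∑[ i < n ] [ i <? σ i ]
      F = ∑[ i < n ] [ i ≟ σ i ]

  ∑-unique-fixed-point : ∀ {n} (σ : Fin n → Fin n) (z : Fin n) →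
                         σ z ≡ z → (∀ i → σ i ≡ i → i ≡ z) → ∑[ i < n ] [ i ≟ σ i ] ≡ 1
  ∑-unique-fixed-point {suc m} σ z σz≡z fixed⇒z = begin
    ∑[ i < suc m ] [ i ≟ σ i ]
      ≡⟨ sum-remove {i = z} (λ i → [ i ≟ σ i ]) ⟩
    [ z ≟ σ z ] + ∑[ k < m ] [ p k ≟ σ (p k) ]
      ≡⟨ cong₂ _+_ fixed-z (trans (sum-cong-≗ moved) (sum-replicate-zero m)) ⟩
    1 ∎
    where
    open ≡-Reasoning
    p = punchIn z
    fixed-z : [ z ≟ σ z ] ≡ 1
    fixed-z with z ≟ σ z
    ... | yes _ = refl
    ... | no z≢σz = contradiction (sym σz≡z) z≢σz
    moved : ∀ k → [ p k ≟ σ (p k) ] ≡ 0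
    moved k with p k ≟ σ (p k)
    ... | yes pk≡σpk = contradiction (fixed⇒z (p k) (sym pk≡σpk)) (punchInᵢ≢i z k)
    ... | no _ = refl

  involution-with-unique-fixed-point⇒odd : ∀ {n} (σ : Fin n → Fin n) → (∀ i → σ (σ i) ≡ i) →
    (z : Fin n) → σ z ≡ z → (∀ i → σ i ≡ i → i ≡ z) → ¬ 2 ∣ n
  involution-with-unique-fixed-point⇒odd {n} σ σ-involutive z σz≡z fixed⇒z (divides j n≡j*2) =
    even≢odd j S (begin
      2 * j       ≡⟨ *-comm 2 j ⟩
      j * 2       ≡⟨ n≡j*2 ⟨
      n           ≡⟨ involution-count σ σ-involutive ⟩
      2 * S + F   ≡⟨ cong (2 * S +_) (∑-unique-fixed-point σ z σz≡z fixed⇒z) ⟩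
      2 * S + 1   ≡⟨ +-comm (2 * S) 1 ⟩
      suc (2 * S) ∎)
    where
    open ≡-Reasoning
    S = ∑[ i < n ] [ i <? σ i ]
    F = ∑[ i < n ] [ i ≟ σ i ]

open InvolutionParity using (involution-with-unique-fixed-point⇒odd)

module FieldProperties {r ℓ : Level} (F : CommutativeRing r ℓ) (isField : IsField F) where
  open CommutativeRing F
  open IsField isField using (inverse)
  open Geometry F
  open import Algebra.Solver.Ring.NaturalCoefficients.Default commutativeSemiring
  open import Algebra.Properties.Group +-group using (inverseˡ-unique)
  open import Relation.Binary.Reasoning.Setoid setoid

  y≈0⇒x*y≈0 : ∀ {x y} → y ≈ 0# → x * y ≈ 0#
  y≈0⇒x*y≈0 {x} y≈0 = trans (*-congˡ y≈0) (zeroʳ x)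

  x≈0⇒x*y≈0 : ∀ {x y} → x ≈ 0# → x * y ≈ 0#
  x≈0⇒x*y≈0 {y = y} x≈0 = trans (*-congʳ x≈0) (zeroˡ y)

  y≈0⇒x+y≈x : ∀ {x y} → y ≈ 0# → x + y ≈ x
  y≈0⇒x+y≈x {x} y≈0 = trans (+-congˡ y≈0) (+-identityʳ x)

  *-cancelˡ : ∀ {x y z} → ¬ x ≈ 0# → x * y ≈ x * z → y ≈ z
  *-cancelˡ {x} {y} {z} x≉0 xy≈xz with inverse x x≉0
  ... | x⁻¹ , xx⁻¹≈1 = begin
    y              ≈⟨ *-identityˡ y ⟨
    1# * y         ≈⟨ *-congʳ xx⁻¹≈1 ⟨
    x * x⁻¹ * y    ≈⟨ reassociate x x⁻¹ y ⟩
    x⁻¹ * (x * y)  ≈⟨ *-congˡ xy≈xz ⟩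
    x⁻¹ * (x * z)  ≈⟨ reassociate x x⁻¹ z ⟨
    x * x⁻¹ * z    ≈⟨ *-congʳ xx⁻¹≈1 ⟩
    1# * z         ≈⟨ *-identityˡ z ⟩
    z              ∎
    where
    reassociate : ∀ x x⁻¹ y → x * x⁻¹ * y ≈ x⁻¹ * (x * y)
    reassociate = solve 3 (λ x x⁻¹ y → x :* x⁻¹ :* y := x⁻¹ :* (x :* y)) refl

  x*y≈0⇒y≈0 : ∀ {x y} → ¬ x ≈ 0# → x * y ≈ 0# → y ≈ 0#
  x*y≈0⇒y≈0 {x} x≉0 xy≈0 = *-cancelˡ x≉0 (trans xy≈0 (sym (zeroʳ x)))

  x≉0∧y≉0⇒x*y≉0 : ∀ {x y} → ¬ x ≈ 0# → ¬ y ≈ 0# → ¬ x * y ≈ 0#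
  x≉0∧y≉0⇒x*y≉0 x≉0 y≉0 xy≈0 = y≉0 (x*y≈0⇒y≈0 x≉0 xy≈0)

  quotient : ∀ {x y} → ¬ x ≈ 0# → ∃ λ z → x * z ≈ y
  quotient {x} {y} x≉0 with inverse x x≉0
  ... | x⁻¹ , xx⁻¹≈1 = x⁻¹ * y , (begin
    x * (x⁻¹ * y)  ≈⟨ *-assoc x x⁻¹ y ⟨
    x * x⁻¹ * y    ≈⟨ *-congʳ xx⁻¹≈1 ⟩
    1# * y         ≈⟨ *-identityˡ y ⟩
    y              ∎)

  ³-distrib-* : ∀ x y → (x * y) ³ ≈ x ³ * y ³
  ³-distrib-* = solve 2 (λ x y → (x :* y) :* (x :* y) :* (x :* y) := (x :* x :* x) :* (y :* y :* y)) refl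

  ³-cong : ∀ {x y} → x ≈ y → x ³ ≈ y ³
  ³-cong x≈y = *-cong (*-cong x≈y x≈y) x≈y

  x≉0⇒x³≉0 : ∀ {x} → ¬ x ≈ 0# → ¬ x ³ ≈ 0#
  x≉0⇒x³≉0 x≉0 = x≉0∧y≉0⇒x*y≉0 (x≉0∧y≉0⇒x*y≉0 x≉0 x≉0) x≉0

  equal-cubes⇒ratio³≈1 : ∀ {a d e} → ¬ a ≈ 0# → a ³ ≈ d ³ → a * e ≈ d → e ³ ≈ 1#
  equal-cubes⇒ratio³≈1 {a} {d} {e} a≉0 a³≈d³ ae≈d = *-cancelˡ (x≉0⇒x³≉0 a≉0) (begin
    a ³ * e ³   ≈⟨ ³-distrib-* a e ⟨
    (a * e) ³   ≈⟨ ³-cong ae≈d ⟩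
    d ³         ≈⟨ a³≈d³ ⟨
    a ³         ≈⟨ *-identityʳ (a ³) ⟨
    a ³ * 1#    ∎)

  b³+2d³≈0⇒2x³≈-1 : ∀ {b d} → ¬ b ≈ 0# → b ³ + two * d ³ ≈ 0# → ∃ λ x → two * x ³ ≈ - 1#
  b³+2d³≈0⇒2x³≈-1 {b} {d} b≉0 b³+2d³≈0 =
    x , inverseˡ-unique (two * x ³) 1# (x*y≈0⇒y≈0 (x≉0⇒x³≉0 b≉0) (begin
      b ³ * (two * x ³ + 1#)   ≈⟨ solve 2 (λ b x → (b :* b :* b) :* (con 2 :* (x :* x :* x) :+ con 1)
                                     := b :* b :* b :+ con 2 :* ((b :* b :* b) :* (x :* x :* x))) refl b x ⟩
      b ³ + two * (b ³ * x ³)  ≈⟨ +-congˡ (*-congˡ (trans (sym (³-distrib-* b x)) (³-cong bx≈d))) ⟩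
      b ³ + two * d ³          ≈⟨ b³+2d³≈0 ⟩
      0#                       ∎))
    where
    x = proj₁ (quotient b≉0)
    bx≈d : b * x ≈ d
    bx≈d = proj₂ (quotient b≉0)

module FiniteFieldProperties {r ℓ : Level} (F : CommutativeRing r ℓ) (isField : IsField F)
                             (q : ℕ) (order : HasOrder F q) where
  open CommutativeRing F
  open Geometry F
  open FieldProperties F isField
  open import Algebra.Solver.Ring.NaturalCoefficients.Default commutativeSemiring
  open import Algebra.Properties.Group +-group using (⁻¹-involutive; ε⁻¹≈ε)
  open import Relation.Binary.Reasoning.Setoid setoid
  open Inverse order using (to; from; from-cong; strictlyInverseˡ; strictlyInverseʳ)

  _≟_ : Decidable _≈_
  x ≟ y with from x Fin.≟ from y
  ... | yes fx≡fy = yes (begin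
    x           ≈⟨ strictlyInverseˡ x ⟨
    to (from x) ≡⟨ ≡.cong to fx≡fy ⟩
    to (from y) ≈⟨ strictlyInverseˡ y ⟩
    y           ∎)
  ... | no fx≢fy = no (λ x≈y → fx≢fy (from-cong x≈y))

  two≉0⇒odd-order : ¬ two ≈ 0# → ¬ 2 ∣ q
  two≉0⇒odd-order two≉0 =
    involution-with-unique-fixed-point⇒odd negate negate-involutive (from 0#) negate-0 fixed⇒0
    where
    negate : Fin q → Fin q
    negate i = from (- to i)

    negate-involutive : ∀ i → negate (negate i) ≡.≡ i
    negate-involutive i = ≡.trans
      (from-cong (trans (-‿cong (strictlyInverseˡ (- to i))) (⁻¹-involutive (to i))))
      (strictlyInverseʳ i)

    negate-0 : negate (from 0#) ≡.≡ from 0#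
    negate-0 = from-cong (trans (-‿cong (strictlyInverseˡ 0#)) ε⁻¹≈ε)

    fixed⇒0 : ∀ i → negate i ≡.≡ i → i ≡.≡ from 0#
    fixed⇒0 i negate-i≡i = ≡.trans (≡.sym (strictlyInverseʳ i)) (from-cong t≈0)
      where
      t = to i
      -t≈t : - t ≈ t
      -t≈t = trans (sym (strictlyInverseˡ (- t))) (reflexive (≡.cong to negate-i≡i))
      t≈0 : t ≈ 0#
      t≈0 = x*y≈0⇒y≈0 two≉0 (begin
        two * t    ≈⟨ solve 1 (λ t → con 2 :* t := t :+ t) refl t ⟩
        t + t      ≈⟨ +-congˡ -t≈t ⟨
        t + - t    ≈⟨ -‿inverseʳ t ⟩
        0#         ∎)

module StabiliserOfL {r ℓ : Level} (F : CommutativeRing r ℓ) (isField : IsField F) where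
  open CommutativeRing F
  open IsField isField using (1≉0)
  open Geometry F
  open FieldProperties F isField
  open import Algebra.Solver.Ring.NaturalCoefficients.Default commutativeSemiring
  open import Algebra.Properties.Group +-group using (x≈y⇒x∙y⁻¹≈ε)
  open import Relation.Binary.Reasoning.Setoid setoid

  P₁₀₀₁ P₀₀₁₀ : Vec4
  P₁₀₀₁ 0F = 1#
  P₁₀₀₁ 1F = 0#
  P₁₀₀₁ 2F = 0#
  P₁₀₀₁ 3F = 1#
  P₀₀₁₀ 0F = 0#
  P₀₀₁₀ 1F = 0#
  P₀₀₁₀ 2F = 1#
  P₀₀₁₀ 3F = 0#

  P₁₀₀₁·ᴹ : ∀ M j → (P₁₀₀₁ ·ᴹ M) j ≈ M 0F j + M 3F j
  P₁₀₀₁·ᴹ M j = solve 4 (λ x y z w → con 1 :* x :+ con 0 :* y :+ con 0 :* z :+ con 1 :* w := x :+ w)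
                        refl (M 0F j) (M 1F j) (M 2F j) (M 3F j)

  P₀₀₁₀·ᴹ : ∀ M j → (P₀₀₁₀ ·ᴹ M) j ≈ M 2F j
  P₀₀₁₀·ᴹ M j = solve 4 (λ x y z w → con 0 :* x :+ con 0 :* y :+ con 1 :* z :+ con 0 :* w := z)
                        refl (M 0F j) (M 1F j) (M 2F j) (M 3F j)

  fixesL⇒P₁₀₀₁-equations : ∀ {a b c d} → FixesL (Mabcd a b c d) →
    (a * a * c + b * b * d ≈ 0#) × (a ³ + b ³ ≈ c ³ + d ³)
  fixesL⇒P₁₀₀₁-equations {a} {b} {c} {d} (maps-L , _)
    with maps-L P₁₀₀₁ (λ P≈0 → 1≉0 (P≈0 0F)) (refl , refl)
  ... | x₁≈0 , x₀≈x₃ = trans (sym (P₁₀₀₁·ᴹ M 1F)) x₁≈0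
                     , trans (sym (P₁₀₀₁·ᴹ M 0F)) (trans x₀≈x₃ (P₁₀₀₁·ᴹ M 3F))
    where M = Mabcd a b c d

  fixesL⇒P₀₀₁₀-equations : ∀ {a b c d} → FixesL (Mabcd a b c d) →
    (b * b * c + two * a * b * d ≈ 0#) × (three * a * b * b ≈ three * c * d * d)
  fixesL⇒P₀₀₁₀-equations {a} {b} {c} {d} (maps-L , _)
    with maps-L P₀₀₁₀ (λ P≈0 → 1≉0 (P≈0 2F)) (refl , refl)
  ... | x₁≈0 , x₀≈x₃ = trans (sym (P₀₀₁₀·ᴹ M 1F)) x₁≈0
                     , trans (sym (P₀₀₁₀·ᴹ M 0F)) (trans x₀≈x₃ (P₀₀₁₀·ᴹ M 3F))
    where M = Mabcd a b c d

  Mabcd-diagonal : ∀ {a b c d e} → b ≈ 0# → c ≈ 0# → a * e ≈ d →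
                   ∀ i j → Mabcd a b c d i j ≈ a ³ * diagCube e i j
  Mabcd-diagonal {a} {b} {c} {d} {e} b≈0 c≈0 ae≈d = entry
    where
    vanishes : ∀ {x} → x ≈ 0# → x ≈ a ³ * 0#
    vanishes x≈0 = trans x≈0 (sym (zeroʳ (a ³)))

    x≈0∧y≈0⇒x+y≈0 : ∀ {x y} → x ≈ 0# → y ≈ 0# → x + y ≈ 0#
    x≈0∧y≈0⇒x+y≈0 x≈0 y≈0 = trans (y≈0⇒x+y≈x y≈0) x≈0

    entry : ∀ i j → Mabcd a b c d i j ≈ a ³ * diagCube e i j
    entry 0F 0F = sym (*-identityʳ (a ³))
    entry 0F 1F = vanishes (y≈0⇒x*y≈0 c≈0)
    entry 0F 2F = vanishes (y≈0⇒x*y≈0 c≈0)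
    entry 0F 3F = vanishes (y≈0⇒x*y≈0 c≈0)
    entry 1F 0F = vanishes (y≈0⇒x*y≈0 b≈0)
    entry 1F 1F = trans (y≈0⇒x+y≈x (y≈0⇒x*y≈0 c≈0))
      (trans (*-congˡ (sym ae≈d)) (solve 2 (λ a e → a :* a :* (a :* e) := (a :* a :* a) :* e) refl a e))
    entry 1F 2F = vanishes (x≈0∧y≈0⇒x+y≈0 (y≈0⇒x*y≈0 c≈0) (x≈0⇒x*y≈0 (y≈0⇒x*y≈0 c≈0)))
    entry 1F 3F = vanishes (x≈0⇒x*y≈0 (y≈0⇒x*y≈0 c≈0))
    entry 2F 0F = vanishes (y≈0⇒x*y≈0 b≈0)
    entry 2F 1F = vanishes (x≈0∧y≈0⇒x+y≈0 (y≈0⇒x*y≈0 c≈0) (x≈0⇒x*y≈0 (y≈0⇒x*y≈0 b≈0)))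
    entry 2F 2F = trans (y≈0⇒x+y≈x (x≈0⇒x*y≈0 (y≈0⇒x*y≈0 c≈0)))
      (trans (*-cong (*-congˡ (sym ae≈d)) (sym ae≈d))
        (solve 2 (λ a e → a :* (a :* e) :* (a :* e) := (a :* a :* a) :* (e :* e)) refl a e))
    entry 2F 3F = vanishes (x≈0⇒x*y≈0 (x≈0⇒x*y≈0 (y≈0⇒x*y≈0 c≈0)))
    entry 3F 0F = vanishes (y≈0⇒x*y≈0 b≈0)
    entry 3F 1F = vanishes (x≈0⇒x*y≈0 (y≈0⇒x*y≈0 b≈0))
    entry 3F 2F = vanishes (x≈0⇒x*y≈0 (x≈0⇒x*y≈0 b≈0))
    entry 3F 3F = trans (*-cong (*-cong (sym ae≈d) (sym ae≈d)) (sym ae≈d)) (³-distrib-* a e)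

  diagonal-case : ∀ {a b c d} → b ≈ 0# → ¬ a * d ≈ b * c →
    a * a * c + b * b * d ≈ 0# → a ³ + b ³ ≈ c ³ + d ³ →
    ∃ λ e → (e ³ ≈ 1#) × SameProjectivity (diagCube e) (Mabcd a b c d)
  diagonal-case {a} {b} {c} {d} b≈0 ad≉bc a²c+b²d≈0 a³+b³≈c³+d³ =
    e , equal-cubes⇒ratio³≈1 a≉0 a³≈d³ ae≈d , a ³ , x≉0⇒x³≉0 a≉0 , Mabcd-diagonal b≈0 c≈0 ae≈d
    where
    a≉0 : ¬ a ≈ 0#
    a≉0 a≈0 = ad≉bc (trans (x≈0⇒x*y≈0 a≈0) (sym (x≈0⇒x*y≈0 b≈0)))
    e = proj₁ (quotient a≉0)
    ae≈d : a * e ≈ d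
    ae≈d = proj₂ (quotient a≉0)
    c≈0 : c ≈ 0#
    c≈0 = x*y≈0⇒y≈0 (x≉0∧y≉0⇒x*y≉0 a≉0 a≉0)
            (trans (sym (y≈0⇒x+y≈x (x≈0⇒x*y≈0 (y≈0⇒x*y≈0 b≈0)))) a²c+b²d≈0)
    a³≈d³ : a ³ ≈ d ³
    a³≈d³ = begin
      a ³          ≈⟨ y≈0⇒x+y≈x (y≈0⇒x*y≈0 b≈0) ⟨
      a ³ + b ³    ≈⟨ a³+b³≈c³+d³ ⟩
      c ³ + d ³    ≈⟨ +-congʳ (y≈0⇒x*y≈0 c≈0) ⟩
      0# + d ³     ≈⟨ +-identityˡ (d ³) ⟩
      d ³          ∎

  non-diagonal-case : ∀ {a b c d} → ¬ b ≈ 0# → ¬ a * d ≈ b * c →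
    a * a * c + b * b * d ≈ 0# →
    b * b * c + two * a * b * d ≈ 0# → three * a * b * b ≈ three * c * d * d →
    ¬ two ≈ 0# × ∃ λ x → two * x ³ ≈ - 1#
  non-diagonal-case {a} {b} {c} {d} b≉0 ad≉bc a²c+b²d≈0 b²c+2abd≈0 3ab²≈3cd² =
    two≉0 , b³+2d³≈0⇒2x³≈-1 b≉0 b³+2d³≈0
    where
    bc+2ad≈0 : b * c + two * a * d ≈ 0#
    bc+2ad≈0 = x*y≈0⇒y≈0 b≉0 (trans
      (solve 4 (λ a b c d → b :* (b :* c :+ con 2 :* a :* d) := b :* b :* c :+ con 2 :* a :* b :* d) refl a b c d)
      b²c+2abd≈0)

    3ad≉0 : ¬ three * a * d ≈ 0#
    3ad≉0 3ad≈0 = ad≉bc (begin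
      a * d                            ≈⟨ y≈0⇒x+y≈x bc+2ad≈0 ⟨
      a * d + (b * c + two * a * d)    ≈⟨ solve 4 (λ a b c d → a :* d :+ (b :* c :+ con 2 :* a :* d)
                                                         := b :* c :+ con 3 :* a :* d) refl a b c d ⟩
      b * c + three * a * d            ≈⟨ y≈0⇒x+y≈x 3ad≈0 ⟩
      b * c                            ∎)

    d≉0 : ¬ d ≈ 0#
    d≉0 d≈0 = 3ad≉0 (y≈0⇒x*y≈0 d≈0)

    3a≉0 : ¬ three * a ≈ 0#
    3a≉0 3a≈0 = 3ad≉0 (x≈0⇒x*y≈0 3a≈0)

    two≉0 : ¬ two ≈ 0#
    two≉0 two≈0 = x≉0∧y≉0⇒x*y≉0 (x≉0∧y≉0⇒x*y≉0 b≉0 b≉0) d≉0 (begin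
      b * b * d              ≈⟨ +-identityˡ (b * b * d) ⟨
      0# + b * b * d         ≈⟨ +-congʳ (y≈0⇒x*y≈0 c≈0) ⟨
      a * a * c + b * b * d  ≈⟨ a²c+b²d≈0 ⟩
      0#                     ∎)
      where
      c≈0 : c ≈ 0#
      c≈0 = x*y≈0⇒y≈0 b≉0
        (trans (sym (y≈0⇒x+y≈x (x≈0⇒x*y≈0 (x≈0⇒x*y≈0 two≈0)))) bc+2ad≈0)

    b³+2d³≈0 : b ³ + two * d ³ ≈ 0#
    b³+2d³≈0 = x*y≈0⇒y≈0 3a≉0 (begin
      three * a * (b ³ + two * d ³)
        ≈⟨ solve 3 (λ a b d → con 3 :* a :* (b :* b :* b :+ con 2 :* (d :* d :* d))
                     := b :* (con 3 :* a :* b :* b) :+ con 3 :* (d :* d) :* (con 2 :* a :* d)) refl a b d ⟩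
      b * (three * a * b * b) + three * (d * d) * (two * a * d)
        ≈⟨ +-congʳ (*-congˡ 3ab²≈3cd²) ⟩
      b * (three * c * d * d) + three * (d * d) * (two * a * d)
        ≈⟨ solve 4 (λ a b c d → b :* (con 3 :* c :* d :* d) :+ con 3 :* (d :* d) :* (con 2 :* a :* d)
                     := con 3 :* (d :* d) :* (b :* c :+ con 2 :* a :* d)) refl a b c d ⟩
      three * (d * d) * (b * c + two * a * d)
        ≈⟨ y≈0⇒x*y≈0 bc+2ad≈0 ⟩
      0# ∎)

  module _ (q : ℕ) (order : HasOrder F q) where
    open FiniteFieldProperties F isField q order

    stabiliser-of-L : (2 ∣ q ⊎ (∀ h → two * h ≈ - 1# → ¬ (∃ λ x → x ³ ≈ h))) →
      ∀ a b c d → ¬ (a * d - b * c ≈ 0#) →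
      FixesL (Mabcd a b c d) →
      ∃ λ e → (e ³ ≈ 1#) × SameProjectivity (diagCube e) (Mabcd a b c d)
    stabiliser-of-L even-or-no-cube a b c d Δ≉0 fixesL = by-cases (b ≟ 0#)
      where
      ad≉bc : ¬ a * d ≈ b * c
      ad≉bc ad≈bc = Δ≉0 (x≈y⇒x∙y⁻¹≈ε ad≈bc)

      P₁₀₀₁-equations : (a * a * c + b * b * d ≈ 0#) × (a ³ + b ³ ≈ c ³ + d ³)
      P₁₀₀₁-equations = fixesL⇒P₁₀₀₁-equations fixesL

      P₀₀₁₀-equations : (b * b * c + two * a * b * d ≈ 0#) × (three * a * b * b ≈ three * c * d * d)
      P₀₀₁₀-equations = fixesL⇒P₀₀₁₀-equations fixesL

      ¬[two≉0∧2x³≈-1] : ¬ (¬ two ≈ 0# × ∃ λ x → two * x ³ ≈ - 1#)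
      ¬[two≉0∧2x³≈-1] (two≉0 , x , 2x³≈-1) =
        [ two≉0⇒odd-order two≉0 , (λ no-cube → no-cube (x ³) 2x³≈-1 (x , refl)) ] even-or-no-cube

      by-cases : Dec (b ≈ 0#) → ∃ λ e → (e ³ ≈ 1#) × SameProjectivity (diagCube e) (Mabcd a b c d)
      by-cases (yes b≈0) = diagonal-case b≈0 ad≉bc (proj₁ P₁₀₀₁-equations) (proj₂ P₁₀₀₁-equations)
      by-cases (no b≉0) = ⊥-elim (¬[two≉0∧2x³≈-1] (non-diagonal-case b≉0 ad≉bc
        (proj₁ P₁₀₀₁-equations) (proj₁ P₀₀₁₀-equations) (proj₂ P₀₀₁₀-equations)))

lemma3p3 : {c ℓ : Level} (F : CommutativeRing c ℓ) → IsField F →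
    (q : ℕ) → HasOrder F q → q ≥ 5 →
    let open CommutativeRing F
        open Geometry F
    in (2 ∣ q ⊎ (∀ h → two * h ≈ - 1# → ¬ (∃ λ x → x ³ ≈ h))) →
    ∀ a b c' d → ¬ (a * d - b * c' ≈ 0#) →
    FixesL (Mabcd a b c' d) →
    ∃ λ e → (e ³ ≈ 1#) × SameProjectivity (diagCube e) (Mabcd a b c' d)
-- q ≥ 5 is what makes every element of G_q have the form M(a,b,c,d), which the
-- statement already presupposes.
lemma3p3 F isField q order _ = StabiliserOfL.stabiliser-of-L F isField q order
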